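{- Let $\mathsf{T}:\mathsf{Krip}\to\mathsf{Pos}$ be a functor, $\Lambda$ a set of predicate liftings for $\mathsf{T}$, $\phi\in\mathcal{L}(\Lambda)$, and $\mathcal{X}$ an $(\mathsf{i},\mathsf{T})$-dialgebra with $\mathcal{X}\Vdash\phi$. (1) If $\mathcal{X}'$ is a generated subframe of $\mathcal{X}$ then $\mathcal{X}'\Vdash\phi$. (2) If $\mathcal{X}'$ is a p-morphic image of $\mathcal{X}$ then $\mathcal{X}'\Vdash\phi$.
   Context: $\mathsf{Krip}$: posets and p-morphisms (order-preserving $f$ such that $f(x)\le' y'$ implies some $y\ge x$ has $f(y)=y'$); $\mathsf{Pos}$: posets and order-preserving maps; $\mathsf{i}$ the inclusion. An $(\mathsf{i},\mathsf{T})$-dialgebra is $(X,\le,\gamma)$ with $\gamma:(X,\le)\to\mathsf{T}(X,\le)$ order-preserving; morphisms are p-morphisms $f$ with $\mathsf{T}f\circ\gamma=\gamma'\circ f$. $\mathcal{X}'$ is a generated subframe of $\mathcal{X}$ if there is a dialgebra morphism $\mathcal{X}'\to\mathcal{X}$ that is an order-embedding of underlying posets; it is a p-morphic image of $\mathcal{X}$ if there is a surjective dialgebra morphism $\mathcal{X}\to\mathcal{X}'$. Predicate liftings: families $\lambda_{(X,\le)}:\mathrm{Up}(X,\le)^n\to\mathrm{Up}(\mathsf{T}(X,\le))$ with $\lambda(f^{ -1}a_1,\dots,f^{ -1}a_n)=(\mathsf{T}f)^{ -1}\lambda(a_1,\dots,a_n)$ for p-morphisms $f$. $\mathcal{L}(\Lambda)$: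 intuitionistic propositional formulas over a countably infinite set of letters closed under $\heartsuit^\lambda(\phi_1,\dots,\phi_n)$. Under a valuation into upsets, connectives are intuitionistic and $x\Vdash\heartsuit^\lambda(\phi_1,\dots)$ iff $\gamma(x)\in\lambda_{(X,\le)}([\![\phi_1]\!],\dots)$. $\mathcal{X}\Vdash\phi$ means $\phi$ holds at every state under every valuation. -}

module Defs where

open import Level using (0ℓ)
open import Data.Nat using (ℕ)
open import Data.Fin using (Fin)
open import Data.Product using (Σ; ∃; _×_; _,_; proj₁; proj₂)
open import Data.Empty using (⊥)
open import Data.Unit using (⊤)
open import Data.Sum using (_⊎_; inj₁; inj₂)
open import Function using (_∘_)
open import Function.Bundles using (_⇔_)
open import Relation.Binary using (Rel; IsPartialOrder)
open import Relation.Binary.PropositionalEquality using (_≡_)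

record Pos : Set₁ where
  field
    Carrier        : Set
    _≤_            : Rel Carrier 0ℓ
    isPartialOrder : IsPartialOrder _≡_ _≤_
  open IsPartialOrder isPartialOrder public
    using () renaming (refl to ≤-refl; trans to ≤-trans; antisym to ≤-antisym)

open Pos public using (Carrier)

record Mono (X Y : Pos) : Set where
  private
    module X = Pos X
    module Y = Pos Y
  field
    fun  : Carrier X → Carrier Y
    mono : ∀ {x y} → x X.≤ y → fun x Y.≤ fun y
open Mono public

record PMor (X Y : Pos) : Set where
  private
    module X = Pos X
    module Y = Pos Y
  field
    pfun  : Carrier X → Carrier Y
    pmono : ∀ {x y} → x X.≤ y → pfun x Y.≤ pfun y
    back  : ∀ x y' → pfun x Y.≤ y' → Σ (Carrier X) λ y → (x X.≤ y) × (pfun y ≡ y')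
open PMor public

idP : (X : Pos) → PMor X X
idP X = record
  { pfun = λ x → x ; pmono = λ p → p
  ; back = λ x y' p → y' , p , Relation.Binary.PropositionalEquality.refl }

_∘P_ : ∀ {X Y Z} → PMor Y Z → PMor X Y → PMor X Z
_∘P_ {X} {Y} {Z} g f = record
  { pfun  = pfun g ∘ pfun f
  ; pmono = pmono g ∘ pmono f
  ; back  = bk }
  where
  open Relation.Binary.PropositionalEquality using (subst; sym)
  bk : ∀ x z → Pos._≤_ Z (pfun g (pfun f x)) z →
       Σ (Carrier X) λ y → (Pos._≤_ X x y) × (pfun g (pfun f y) ≡ z)
  bk x z p with back g (pfun f x) z p
  ... | y₁ , q₁ , e₁ with back f x y₁ q₁
  ... | y , q , e = y , q , subst (λ w → pfun g w ≡ z) (sym e) e₁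

record Functor : Set₁ where
  field
    obj      : Pos → Pos
    map      : ∀ {X Y} → PMor X Y → Mono (obj X) (obj Y)
    map-cong : ∀ {X Y} (f g : PMor X Y) → (∀ x → pfun f x ≡ pfun g x) →
               ∀ t → fun (map f) t ≡ fun (map g) t
    map-id   : ∀ X t → fun (map (idP X)) t ≡ t
    map-∘    : ∀ {X Y Z} (g : PMor Y Z) (f : PMor X Y) t →
               fun (map (g ∘P f)) t ≡ fun (map g) (fun (map f) t)
open Functor public

record Up (X : Pos) : Set₁ where
  field
    pred   : Carrier X → Set
    upward : ∀ {x y} → Pos._≤_ X x y → pred x → pred y
open Up public

-- extensional equality of upsets (upsets are sets)
_≈Up_ : ∀ {X} → Up X → Up X → Set
_≈Up_ {X} a b = ∀ x → pred a x ⇔ pred b x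

preimage : ∀ {X Y} → PMor X Y → Up Y → Up X
preimage f a = record
  { pred = λ x → pred a (pfun f x)
  ; upward = λ p → upward a (pmono f p) }

preimageM : ∀ {X Y} → Mono X Y → Up Y → Up X
preimageM f a = record
  { pred = λ x → pred a (fun f x)
  ; upward = λ p → upward a (mono f p) }

record PredLifting (T : Functor) (n : ℕ) : Set₁ where
  field
    lift    : ∀ X → (Fin n → Up X) → Up (obj T X)
    -- well defined on upsets as sets
    lift-cong : ∀ X (as bs : Fin n → Up X) → (∀ i → as i ≈Up bs i) →
                lift X as ≈Up lift X bs
    natural : ∀ {X Y} (f : PMor X Y) (as : Fin n → Up Y) →
              lift X (preimage f ∘ as) ≈Up preimageM (map T f) (lift Y as)
open PredLifting public

-- a set Λ of predicate liftings, indexed by a type of names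
record Liftings (T : Functor) : Set₁ where
  field
    Name   : Set
    arity  : Name → ℕ
    lifting : (l : Name) → PredLifting T (arity l)
open Liftings public

data Form {T : Functor} (Λ : Liftings T) : Set where
  var  : ℕ → Form Λ
  ⊤'   : Form Λ
  ⊥'   : Form Λ
  _∧'_ : Form Λ → Form Λ → Form Λ
  _∨'_ : Form Λ → Form Λ → Form Λ
  _⇒'_ : Form Λ → Form Λ → Form Λ
  ♥    : (l : Name Λ) → (Fin (arity Λ l) → Form Λ) → Form Λ

record Dialg (T : Functor) : Set₁ where
  field
    pos : Pos
    γ   : Mono pos (obj T pos)
open Dialg public

record DMor {T : Functor} (A B : Dialg T) : Set where
  field
    mor : PMor (pos A) (pos B)
    comm : ∀ x → fun (map T mor) (fun (γ A) x) ≡ fun (γ B) (pfun mor x)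
open DMor public

OrderEmbedding : ∀ {X Y} → PMor X Y → Set
OrderEmbedding {X} {Y} f =
  ∀ x y → (Pos._≤_ Y (pfun f x) (pfun f y) → Pos._≤_ X x y)
        × (Pos._≤_ X x y → Pos._≤_ Y (pfun f x) (pfun f y))

Surjective : ∀ {X Y} → PMor X Y → Set
Surjective {X} {Y} f = ∀ y → Σ (Carrier X) λ x → pfun f x ≡ y

GeneratedSubframe : ∀ {T} → Dialg T → Dialg T → Set
GeneratedSubframe A' A = Σ (DMor A' A) λ f → OrderEmbedding (mor f)

PMorphicImage : ∀ {T} → Dialg T → Dialg T → Set
PMorphicImage A' A = Σ (DMor A A') λ f → Surjective (mor f)

Valuation : Pos → Set₁
Valuation X = ℕ → Up X

module _ {T : Functor} {Λ : Liftings T} (A : Dialg T) (V : Valuation (pos A)) where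
  private
    X = pos A
    _≤_ = Pos._≤_ X

  mutual
    sat : Form Λ → Carrier X → Set
    sat (var p) x = pred (V p) x
    sat ⊤' x = ⊤
    sat ⊥' x = ⊥
    sat (φ ∧' ψ) x = sat φ x × sat ψ x
    sat (φ ∨' ψ) x = sat φ x ⊎ sat ψ x
    sat (φ ⇒' ψ) x = ∀ y → x ≤ y → sat φ y → sat ψ y
    sat (♥ l φs) x = pred (lift (lifting Λ l) X (λ i → ⟦ φs i ⟧)) (fun (γ A) x)

    sat-up : ∀ φ {x y} → x ≤ y → sat φ x → sat φ y
    sat-up (var p) le s = upward (V p) le s
    sat-up ⊤' le s = s
    sat-up ⊥' le s = s
    sat-up (φ ∧' ψ) le (s , t) = sat-up φ le s , sat-up ψ le t
    sat-up (φ ∨' ψ) le (inj₁ s) = inj₁ (sat-up φ le s)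
    sat-up (φ ∨' ψ) le (inj₂ s) = inj₂ (sat-up ψ le s)
    sat-up (φ ⇒' ψ) le s z le' = s z (Pos.≤-trans X le le')
    sat-up (♥ l φs) le s =
      upward (lift (lifting Λ l) X (λ i → ⟦ φs i ⟧)) (mono (γ A) le) s

    ⟦_⟧ : Form Λ → Up X
    ⟦ φ ⟧ = record { pred = sat φ ; upward = sat-up φ }

_⊩_ : ∀ {T} {Λ : Liftings T} → Dialg T → Form Λ → Set₁
A ⊩ φ = ∀ (V : Valuation (pos A)) (x : Carrier (pos A)) → sat A V φ x

-- A morphism of dialgebras f : A → B preserves and reflects truth: if a
-- valuation W on A is the pullback of V on B, then ⟦φ⟧_W = f⁻¹⟦φ⟧_V. The
-- implication case uses that f is a p-morphism, the modal case the naturality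
-- of the liftings together with f ∘ γ = T f ∘ γ. Validity then transfers
-- to a p-morphic image because every valuation on it pulls back, and to a
-- generated subframe because every valuation on it is the pullback of its
-- upward closure along the (order-reflecting) embedding.
module Submission where

open import Defs
open import Data.Fin using (Fin)
open import Data.Product using (_×_; _,_; Σ; proj₁)
open import Data.Product.Function.NonDependent.Propositional using (_×-⇔_)
open import Data.Sum.Function.Propositional using (_⊎-⇔_)
open import Function using (_∘_)
open import Function.Bundles using (_⇔_; mk⇔; Equivalence)
import Function.Properties.Equivalence as ⇔
open import Relation.Binary.PropositionalEquality using (_≡_; refl; sym; subst)

open Equivalence using (to; from)

≡⇒⇔ : {A : Set} (P : A → Set) {a b : A} → a ≡ b → P a ⇔ P b
≡⇒⇔ P a≡b = mk⇔ (subst P a≡b) (subst P (sym a≡b))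

module _ {T : Functor} {Λ : Liftings T} {A B : Dialg T} (f : DMor A B)
         {V : Valuation (pos B)} {W : Valuation (pos A)}
         (W≈V∘f : ∀ p → preimage (mor f) (V p) ≈Up W p) where

  private
    F : PMor (pos A) (pos B)
    F = mor f

  sat-preimage : (φ : Form Λ) → preimage F (⟦_⟧ B V φ) ≈Up ⟦_⟧ A W φ
  sat-preimage (var p)  x = W≈V∘f p x
  sat-preimage ⊤'       x = ⇔.refl
  sat-preimage ⊥'       x = ⇔.refl
  sat-preimage (φ ∧' ψ) x = sat-preimage φ x ×-⇔ sat-preimage ψ x
  sat-preimage (φ ∨' ψ) x = sat-preimage φ x ⊎-⇔ sat-preimage ψ x
  sat-preimage (φ ⇒' ψ) x = mk⇔ forth back'
    where
    forth : sat B V (φ ⇒' ψ) (pfun F x) → sat A W (φ ⇒' ψ) x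
    forth s y x≤y φy =
      to (sat-preimage ψ y) (s (pfun F y) (pmono F x≤y) (from (sat-preimage φ y) φy))

    along : sat A W (φ ⇒' ψ) x → ∀ {y'} → sat B V φ y' →
            Σ (Carrier (pos A)) (λ y → Pos._≤_ (pos A) x y × pfun F y ≡ y') → sat B V ψ y'
    along s φy' (y , x≤y , refl) =
      from (sat-preimage ψ y) (s y x≤y (to (sat-preimage φ y) φy'))

    back' : sat A W (φ ⇒' ψ) x → sat B V (φ ⇒' ψ) (pfun F x)
    back' s y' fx≤y' φy' = along s φy' (back F x y' fx≤y')
  sat-preimage (♥ l φs) x =
    ⇔.trans (≡⇒⇔ (pred liftB) (sym (comm f x)))
      (⇔.trans (⇔.sym (natural λₗ F ⟦φs⟧B (fun (γ A) x)))
        (lift-cong λₗ (pos A) (preimage F ∘ ⟦φs⟧B) (⟦_⟧ A W ∘ φs)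
          (sat-preimage ∘ φs) (fun (γ A) x)))
    where
    λₗ : PredLifting T (arity Λ l)
    λₗ = lifting Λ l
    ⟦φs⟧B : Fin (arity Λ l) → Up (pos B)
    ⟦φs⟧B = ⟦_⟧ B V ∘ φs
    liftB : Up (obj T (pos B))
    liftB = lift λₗ (pos B) ⟦φs⟧B

⊩-image : ∀ {T} {Λ : Liftings T} {A B : Dialg T} (f : DMor A B) →
          Surjective (mor f) → (φ : Form Λ) → A ⊩ φ → B ⊩ φ
⊩-image f surj φ A⊩φ V y with surj y
... | x , refl = from (sat-preimage f (λ p x → ⇔.refl) φ x) (A⊩φ (preimage (mor f) ∘ V) x)

↑image : ∀ {X Y} → PMor X Y → Up X → Up Y
↑image {X} {Y} f a = record
  { pred   = λ y → Σ (Carrier X) λ x → pred a x × Pos._≤_ Y (pfun f x) y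
  ; upward = λ y≤y' (x , ax , fx≤y) → x , ax , Pos.≤-trans Y fx≤y y≤y' }

preimage-↑image : ∀ {X Y} (f : PMor X Y) →
                  (∀ x y → Pos._≤_ Y (pfun f x) (pfun f y) → Pos._≤_ X x y) →
                  (a : Up X) → preimage f (↑image f a) ≈Up a
preimage-↑image {X} f reflects a x =
  mk⇔ (λ (z , az , fz≤fx) → upward a (reflects z x fz≤fx) az)
      (λ ax → x , ax , pmono f (Pos.≤-refl X))

⊩-generatedSubframe : ∀ {T} {Λ : Liftings T} {A B : Dialg T} (f : DMor A B) →
                      OrderEmbedding (mor f) → (φ : Form Λ) → B ⊩ φ → A ⊩ φ
⊩-generatedSubframe f emb φ B⊩φ W x =
  to (sat-preimage f W≈V∘f φ x) (B⊩φ (↑image (mor f) ∘ W) (pfun (mor f) x))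
  where
  W≈V∘f : ∀ p → preimage (mor f) (↑image (mor f) (W p)) ≈Up W p
  W≈V∘f p = preimage-↑image (mor f) (λ x y → proj₁ (emb x y)) (W p)

proposition3p14 : (T : Functor) (Λ : Liftings T) (φ : Form Λ) (A : Dialg T) →
    A ⊩ φ →
    ((A' : Dialg T) → GeneratedSubframe A' A → A' ⊩ φ)
    × ((A' : Dialg T) → PMorphicImage A' A → A' ⊩ φ)
proposition3p14 T Λ φ A A⊩φ =
  (λ A' (f , emb)  → ⊩-generatedSubframe f emb φ A⊩φ) ,
  (λ A' (f , surj) → ⊩-image f surj φ A⊩φ)
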